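{- If $w\in\{0,1\}^{\omega}$ and $n\ge2$, then \[ d_{n-1}(w)\le d_n(w)\le (n-1)\,d_{n-1}(w). \]
   Context: $\{0,1\}^{\omega}$ is the set of infinite binary words $w=w_1w_2\cdots$, and $w[k]=w_1\cdots w_k$. For $\pi=\pi_1\cdots\pi_n\in\mathfrak{S}_n$, the descent word is $\mathrm{Des}(\pi)=x_1\cdots x_{n-1}$ with $x_i=1$ iff $\pi_i>\pi_{i+1}$. $d_n(w)$ is the number of $\pi\in\mathfrak{S}_n$ with $\mathrm{Des}(\pi)=w[n-1]$. -}

module Defs where

open import Data.Nat using (ℕ; zero; suc; _<ᵇ_)
open import Data.Bool using (Bool; true; false; _∧_; if_then_else_)
open import Data.List using (List; []; _∷_; concatMap; map; length; filterᵇ; allFin)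
open import Data.Fin using (Fin; toℕ; _≟_)
open import Data.Vec using (Vec; []; _∷_; toList)
open import Relation.Nullary.Decidable using (⌊_⌋)

-- An infinite binary word w = w₁ w₂ ⋯ is a function ℕ → Bool,
-- with  w i  representing the letter w_{i+1}  (true = 1, false = 0).
Word : Set
Word = ℕ → Bool

allVecs : (k n : ℕ) → List (Vec (Fin n) k)
allVecs zero    n = [] ∷ []
allVecs (suc k) n = concatMap (λ v → map (_∷ v) (allFin n)) (allVecs k n)

notIn : ∀ {n} → Fin n → List (Fin n) → Bool
notIn x []       = true
notIn x (y ∷ ys) = (if ⌊ x ≟ y ⌋ then false else true) ∧ notIn x ys

distinct : ∀ {n} → List (Fin n) → Bool
distinct []       = true
distinct (x ∷ xs) = notIn x xs ∧ distinct xs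

isPerm : ∀ {n} → Vec (Fin n) n → Bool
isPerm v = distinct (toList v)

_==_ : Bool → Bool → Bool
true  == b = b
false == true  = false
false == false = true

-- descAgrees i π w : for each consecutive pair (π_j, π_{j+1}) (j = i+1, i+2, …),
-- the descent indicator [π_j > π_{j+1}] equals the letter w_j ( = w (j ∸ 1) ).
descAgrees : ∀ {n} → ℕ → List (Fin n) → Word → Bool
descAgrees i []            w = true
descAgrees i (x ∷ [])      w = true
descAgrees i (x ∷ y ∷ xs)  w = ((toℕ y <ᵇ toℕ x) == w i) ∧ descAgrees (suc i) (y ∷ xs) w

hasDes : ∀ {n} → Vec (Fin n) n → Word → Bool
hasDes π w = descAgrees 0 (toList π) w

d : ℕ → Word → ℕ
d n w = length (filterᵇ (λ π → isPerm π ∧ hasDes π w) (allVecs n n))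

module Submission where

-- A permutation π ∈ 𝔖_n is determined by its last value ℓ and the standardisation σ ∈ 𝔖_{n-1}
-- of π₁⋯π_{n-1} (π = insertLast ℓ σ), and Des(π) is Des(σ) followed by the bit [π_{n-1} > ℓ].
-- Lower bound: making ℓ the smallest value when w_{n-1} = 1 and the largest otherwise realises
-- the last bit whatever σ is, so σ ↦ insertLast ℓ σ injects the permutations counted by d_{n-1}
-- into those counted by d_n. Upper bound: the last bit forbids ℓ from being the largest value
-- when w_{n-1} = 1 and the smallest otherwise, so π ↦ (ℓ, σ) leaves n-1 choices for ℓ.

open import Defs
open import Data.Bool using (Bool; true; false; not; T; _∧_)
open import Data.Bool.Properties using (T-∧; ∧-assoc; ∧-identityʳ; not-¬)
open import Data.Empty using (⊥-elim)
open import Data.Fin as Fin using (Fin; zero; suc; toℕ; fromℕ; punchIn; punchOut)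
open import Data.Fin.Properties
  using (punchIn-injective; punchIn-mono-≤; punchIn-cancel-≤; punchInᵢ≢i; punchIn-punchOut)
open import Data.List
  using (List; []; _∷_; _++_; _∷ʳ_; map; concatMap; length; filterᵇ; allFin; cartesianProduct; cartesianProductWith)
open import Data.List.Properties using (length-++-sucʳ; length-++; length-map; length-tabulate; map-++)
open import Data.List.Membership.Propositional using (_∈_)
open import Data.List.Membership.Propositional.Properties
  using (∈-∃++; ∈-++⁻; ∈-++⁺ˡ; ∈-++⁺ʳ; ∈-filter⁺; ∈-filter⁻; ∈-map⁺; ∈-map⁻; ∈-allFin; ∈-cartesianProduct⁺; ∈-cartesianProductWith⁺)
open import Data.List.Relation.Binary.Subset.Propositional using (_⊆_)
open import Data.List.Relation.Unary.All as All using (All; []; _∷_)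
open import Data.List.Relation.Unary.AllPairs as AllPairs using ([]; _∷_)
open import Data.List.Relation.Unary.Any using (here; there)
open import Data.List.Relation.Unary.Unique.Propositional using (Unique)
import Data.List.Relation.Unary.Unique.Propositional.Properties as Unique
import Data.List.Relation.Binary.Permutation.Setoid as Perm
import Data.List.Relation.Binary.Permutation.Setoid.Properties as Perm
open import Data.Nat as ℕ using (ℕ; zero; suc; _+_; _*_; _∸_; _≤_; s≤s; z≤n; _<ᵇ_)
open import Data.Nat.Properties as ℕ using (+-suc; +-identityʳ; <ᵇ-reflects-<; <ᵇ⇒<; <⇒<ᵇ; <⇒≱; ≰⇒>)
open import Data.Product using (_×_; _,_; proj₁; proj₂; ∃; ∃₂; swap)
open import Data.Sum using (inj₁; inj₂)
open import Data.Vec as Vec using (Vec; []; _∷_; toList)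
import Data.Vec.Properties as Vec
open import Function using (_∘_; _⇔_; mk⇔; Equivalence; flip; id)
open import Function.Construct.Composition using (_⇔-∘_)
open import Function.Construct.Symmetry using (⇔-sym)
open import Relation.Binary.PropositionalEquality
open import Relation.Binary.PropositionalEquality.Properties using (setoid)
open import Relation.Nullary.Decidable using (yes; no; T?)
open import Relation.Nullary.Reflects using (det; fromEquivalence)

open Equivalence using (to; from)

private
  variable
    A B C : Set
    k n : ℕ

unique-⊆⇒length-≤ : {xs ys : List A} → Unique xs → xs ⊆ ys → length xs ≤ length ys
unique-⊆⇒length-≤ {xs = []} _ _ = z≤n
unique-⊆⇒length-≤ {xs = x ∷ xs} (x∉xs ∷ xs!) xs⊆ys with ∈-∃++ (xs⊆ys (here refl))
... | ys₁ , ys₂ , refl =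
  subst (suc (length xs) ≤_) (sym (length-++-sucʳ ys₁ x ys₂)) (s≤s (unique-⊆⇒length-≤ xs! xs⊆ys₁ys₂))
  where
  xs⊆ys₁ys₂ : xs ⊆ ys₁ ++ ys₂
  xs⊆ys₁ys₂ y∈xs with ∈-++⁻ ys₁ (xs⊆ys (there y∈xs))
  ... | inj₁ y∈ys₁         = ∈-++⁺ˡ y∈ys₁
  ... | inj₂ (here refl)   = ⊥-elim (All.lookup x∉xs y∈xs refl)
  ... | inj₂ (there y∈ys₂) = ∈-++⁺ʳ ys₁ y∈ys₂

length-cartesianProduct : (xs : List A) (ys : List B) →
  length (cartesianProduct xs ys) ≡ length xs * length ys
length-cartesianProduct []       ys = refl
length-cartesianProduct (x ∷ xs) ys = begin
  length (map (x ,_) ys ++ cartesianProduct xs ys)       ≡⟨ length-++ (map (x ,_) ys) ⟩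
  length (map (x ,_) ys) + length (cartesianProduct xs ys) ≡⟨ cong₂ _+_ (length-map (x ,_) ys) (length-cartesianProduct xs ys) ⟩
  length ys + length xs * length ys                       ∎
  where open ≡-Reasoning

concatMap≡cartesianProductWith : (f : A → B → C) (xs : List A) (ys : List B) →
  concatMap (λ x → map (f x) ys) xs ≡ cartesianProductWith f xs ys
concatMap≡cartesianProductWith f []       ys = refl
concatMap≡cartesianProductWith f (x ∷ xs) ys = cong (map (f x) ys ++_) (concatMap≡cartesianProductWith f xs ys)

allVecs-suc : ∀ k n → allVecs (suc k) n ≡ cartesianProductWith (flip _∷_) (allVecs k n) (allFin n)
allVecs-suc k n = concatMap≡cartesianProductWith (flip _∷_) (allVecs k n) (allFin n)

∈-allVecs : (v : Vec (Fin n) k) → v ∈ allVecs k n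
∈-allVecs []      = here refl
∈-allVecs {n} {suc k} (x ∷ v) =
  subst ((x ∷ v) ∈_) (sym (allVecs-suc k n)) (∈-cartesianProductWith⁺ (flip _∷_) (∈-allVecs v) (∈-allFin x))

allVecs-unique : ∀ k n → Unique (allVecs k n)
allVecs-unique zero    n = [] ∷ []
allVecs-unique (suc k) n = subst Unique (sym (allVecs-suc k n))
  (Unique.cartesianProductWith⁺ (flip _∷_) (swap ∘ Vec.∷-injective) (allVecs-unique k n) (Unique.allFin⁺ n))

T-== : {a b : Bool} → T (a == b) ⇔ a ≡ b
T-== {true}  {true}  = mk⇔ (λ _ → refl) _
T-== {true}  {false} = mk⇔ (λ ()) (λ ())
T-== {false} {true}  = mk⇔ (λ ()) (λ ())
T-== {false} {false} = mk⇔ (λ _ → refl) _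

T-notIn : {x : Fin n} (ys : List (Fin n)) → T (notIn x ys) ⇔ All (x ≢_) ys
T-notIn []                     = mk⇔ (λ _ → []) _
T-notIn {x = x} (y ∷ ys) with x Fin.≟ y
... | yes refl = mk⇔ (λ ()) (λ { (x≢x ∷ _) → x≢x refl })
... | no  x≢y  = mk⇔ ((x≢y ∷_) ∘ to (T-notIn ys)) (from (T-notIn ys) ∘ All.tail)

T-distinct : (xs : List (Fin n)) → T (distinct xs) ⇔ Unique xs
T-distinct []       = mk⇔ (λ _ → []) _
T-distinct (x ∷ xs) = mk⇔
  (λ t → let x∉xs , xs! = to T-∧ t in to (T-notIn xs) x∉xs ∷ to (T-distinct xs) xs!)
  (λ { (x∉xs ∷ xs!) → from T-∧ (from (T-notIn xs) x∉xs , from (T-distinct xs) xs!) })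

T-⇔⇒≡ : {a b : Bool} → (T a ⇔ T b) → a ≡ b
T-⇔⇒≡ {true}  {true}  _ = refl
T-⇔⇒≡ {true}  {false} a⇔b = ⊥-elim (to a⇔b _)
T-⇔⇒≡ {false} {true}  a⇔b = ⊥-elim (from a⇔b _)
T-⇔⇒≡ {false} {false} _ = refl

Unique-∷ʳ : {x : A} {xs : List A} → Unique (xs ∷ʳ x) ⇔ Unique (x ∷ xs)
Unique-∷ʳ {A = A} {x} {xs} = mk⇔
  (Perm.Unique-resp-↭ S (Perm.↭-sym S (Perm.∷↭∷ʳ S x xs)))
  (Perm.Unique-resp-↭ S (Perm.∷↭∷ʳ S x xs))
  where S = setoid A

infix 21 _>ᵇ_
_>ᵇ_ : Fin n → Fin n → Bool
x >ᵇ y = toℕ y <ᵇ toℕ x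

>ᵇ-cong : {a b : Fin k} {a′ b′ : Fin n} → (a Fin.≤ b ⇔ a′ Fin.≤ b′) → a >ᵇ b ≡ a′ >ᵇ b′
>ᵇ-cong {a = a} {b} a≤b⇔a′≤b′ = det (<ᵇ-reflects-< (toℕ b) _) (fromEquivalence
  (λ b′<a′ → ≰⇒> (<⇒≱ (<ᵇ⇒< _ _ b′<a′) ∘ to a≤b⇔a′≤b′))
  (λ b<a → <⇒<ᵇ (≰⇒> (<⇒≱ b<a ∘ from a≤b⇔a′≤b′))))

descAgrees-map : (w : Word) (f : Fin k → Fin n) → (∀ {a b} → a Fin.≤ b ⇔ f a Fin.≤ f b) →
  ∀ i xs → descAgrees i (map f xs) w ≡ descAgrees i xs w
descAgrees-map w f f-≤ i []           = refl
descAgrees-map w f f-≤ i (x ∷ [])     = refl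
descAgrees-map w f f-≤ i (x ∷ y ∷ xs) =
  cong₂ (λ b d → (b == w i) ∧ d) (sym (>ᵇ-cong f-≤)) (descAgrees-map w f f-≤ (suc i) (y ∷ xs))

descAgrees-∷ʳ-∷ʳ : (w : Word) (i : ℕ) (xs : List (Fin n)) (a b : Fin n) →
  descAgrees i (xs ∷ʳ a ∷ʳ b) w ≡ descAgrees i (xs ∷ʳ a) w ∧ (a >ᵇ b == w (i + length xs))
descAgrees-∷ʳ-∷ʳ w i [] a b rewrite +-identityʳ i = ∧-identityʳ _
descAgrees-∷ʳ-∷ʳ w i (x ∷ []) a b
  rewrite +-suc i 0 | +-identityʳ i | ∧-identityʳ (x >ᵇ a == w i) | ∧-identityʳ (a >ᵇ b == w (suc i)) = refl
descAgrees-∷ʳ-∷ʳ w i (x ∷ y ∷ xs) a b = begin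
  P ∧ descAgrees (suc i) (y ∷ xs ∷ʳ a ∷ʳ b) w   ≡⟨ cong (P ∧_) (descAgrees-∷ʳ-∷ʳ w (suc i) (y ∷ xs) a b) ⟩
  P ∧ (D ∧ last (suc i + length (y ∷ xs)))     ≡⟨ sym (∧-assoc P D _) ⟩
  (P ∧ D) ∧ last (suc i + length (y ∷ xs))     ≡⟨ cong (λ j → (P ∧ D) ∧ last j) (sym (+-suc i (length (y ∷ xs)))) ⟩
  (P ∧ D) ∧ last (i + length (x ∷ y ∷ xs))     ∎
  where
  open ≡-Reasoning
  P D : Bool
  P = x >ᵇ y == w i
  D = descAgrees (suc i) (y ∷ xs ∷ʳ a) w
  last : ℕ → Bool
  last j = a >ᵇ b == w j

extremeFor : Bool → Fin (suc n)
extremeFor true  = zero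
extremeFor false = fromℕ _

fromℕ-not-descent : (a : Fin (suc n)) → a >ᵇ fromℕ n ≡ false
fromℕ-not-descent             zero    = refl
fromℕ-not-descent {n = suc n} (suc a) = fromℕ-not-descent a

>ᵇ-extremeFor : ∀ b {a : Fin (suc n)} → a ≢ extremeFor b → a >ᵇ extremeFor b ≡ b
>ᵇ-extremeFor true  {zero}  a≢0 = ⊥-elim (a≢0 refl)
>ᵇ-extremeFor true  {suc a} _   = refl
>ᵇ-extremeFor false {a}     _   = fromℕ-not-descent a

>ᵇ⇒≢extremeFor-not : ∀ {b} {a ℓ : Fin (suc n)} → a ≢ ℓ → a >ᵇ ℓ ≡ b → ℓ ≢ extremeFor (not b)
>ᵇ⇒≢extremeFor-not {b = b} a≢ℓ a>ℓ≡b refl = not-¬ a>ℓ≡b (>ᵇ-extremeFor (not b) a≢ℓ)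

Vec-map-injective : {f : A → B} → (∀ {x y} → f x ≡ f y → x ≡ y) →
  {σ τ : Vec A k} → Vec.map f σ ≡ Vec.map f τ → σ ≡ τ
Vec-map-injective f-inj {[]}    {[]}    _  = refl
Vec-map-injective f-inj {x ∷ σ} {y ∷ τ} eq =
  cong₂ _∷_ (f-inj (Vec.∷-injectiveˡ eq)) (Vec-map-injective f-inj (Vec.∷-injectiveʳ eq))

insertLast : Fin (suc n) → Vec (Fin n) k → Vec (Fin (suc n)) (suc k)
insertLast ℓ σ = Vec.map (punchIn ℓ) σ Vec.∷ʳ ℓ

toList-insertLast : (ℓ : Fin (suc n)) (σ : Vec (Fin n) k) →
  toList (insertLast ℓ σ) ≡ map (punchIn ℓ) (toList σ) ∷ʳ ℓ
toList-insertLast ℓ σ = trans (Vec.toList-∷ʳ ℓ (Vec.map (punchIn ℓ) σ)) (cong (_∷ʳ ℓ) (Vec.toList-map (punchIn ℓ) σ))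

insertLast-injective : (ℓ : Fin (suc n)) {σ τ : Vec (Fin n) k} → insertLast ℓ σ ≡ insertLast ℓ τ → σ ≡ τ
insertLast-injective ℓ {σ} {τ} eq =
  Vec-map-injective (punchIn-injective ℓ _ _) (Vec.∷ʳ-injectiveˡ (Vec.map (punchIn ℓ) σ) _ eq)

Unique-insertLast : (ℓ : Fin (suc n)) (xs : List (Fin n)) → Unique (map (punchIn ℓ) xs ∷ʳ ℓ) ⇔ Unique xs
Unique-insertLast ℓ xs = mk⇔
  (λ u → Unique.map⁻ (AllPairs.tail (to Unique-∷ʳ u)))
  (λ xs! → from Unique-∷ʳ (ℓ∉ xs ∷ Unique.map⁺ (punchIn-injective ℓ _ _) xs!))
  where
  ℓ∉ : ∀ ys → All (ℓ ≢_) (map (punchIn ℓ) ys)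
  ℓ∉ []       = []
  ℓ∉ (y ∷ ys) = (punchInᵢ≢i ℓ y ∘ sym) ∷ ℓ∉ ys

distinct-insertLast : (ℓ : Fin (suc n)) (xs : List (Fin n)) → distinct (map (punchIn ℓ) xs ∷ʳ ℓ) ≡ distinct xs
distinct-insertLast ℓ xs =
  T-⇔⇒≡ (⇔-sym (T-distinct xs) ⇔-∘ (Unique-insertLast ℓ xs ⇔-∘ T-distinct (map (punchIn ℓ) xs ∷ʳ ℓ)))

isPerm-insertLast : (ℓ : Fin (suc n)) (σ : Vec (Fin n) n) → isPerm (insertLast ℓ σ) ≡ isPerm σ
isPerm-insertLast ℓ σ = trans (cong distinct (toList-insertLast ℓ σ)) (distinct-insertLast ℓ (toList σ))

punchIn-≤ : (ℓ : Fin (suc n)) {a b : Fin n} → a Fin.≤ b ⇔ punchIn ℓ a Fin.≤ punchIn ℓ b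
punchIn-≤ ℓ {a} {b} = mk⇔ (punchIn-mono-≤ ℓ a b) (punchIn-cancel-≤ ℓ a b)

descAgrees-insertLast : (w : Word) (ℓ : Fin (suc n)) (i : ℕ) (xs : List (Fin n)) (a : Fin n) →
  descAgrees i (map (punchIn ℓ) (xs ∷ʳ a) ∷ʳ ℓ) w ≡ descAgrees i (xs ∷ʳ a) w ∧ (punchIn ℓ a >ᵇ ℓ == w (i + length xs))
descAgrees-insertLast w ℓ i xs a = begin
  descAgrees i (map (punchIn ℓ) (xs ∷ʳ a) ∷ʳ ℓ) w
    ≡⟨ cong (λ ys → descAgrees i (ys ∷ʳ ℓ) w) (map-++ (punchIn ℓ) xs (a ∷ [])) ⟩
  descAgrees i (map (punchIn ℓ) xs ∷ʳ punchIn ℓ a ∷ʳ ℓ) w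
    ≡⟨ descAgrees-∷ʳ-∷ʳ w i (map (punchIn ℓ) xs) (punchIn ℓ a) ℓ ⟩
  descAgrees i (map (punchIn ℓ) xs ∷ʳ punchIn ℓ a) w ∧ last (length (map (punchIn ℓ) xs))
    ≡⟨ cong₂ (λ d j → d ∧ last j) prefix (length-map (punchIn ℓ) xs) ⟩
  descAgrees i (xs ∷ʳ a) w ∧ last (length xs)
    ∎
  where
  open ≡-Reasoning
  last : ℕ → Bool
  last j = punchIn ℓ a >ᵇ ℓ == w (i + j)
  prefix : descAgrees i (map (punchIn ℓ) xs ∷ʳ punchIn ℓ a) w ≡ descAgrees i (xs ∷ʳ a) w
  prefix = trans (cong (λ ys → descAgrees i ys w) (sym (map-++ (punchIn ℓ) xs (a ∷ []))))
                 (descAgrees-map w (punchIn ℓ) (punchIn-≤ ℓ) i (xs ∷ʳ a))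

hasDes-insertLast : (w : Word) (ℓ : Fin (suc (suc n))) (zs : Vec (Fin (suc n)) n) (a : Fin (suc n)) →
  hasDes (insertLast ℓ (zs Vec.∷ʳ a)) w ≡ hasDes (zs Vec.∷ʳ a) w ∧ (punchIn ℓ a >ᵇ ℓ == w n)
hasDes-insertLast w ℓ zs a
  rewrite toList-insertLast ℓ (zs Vec.∷ʳ a) | Vec.toList-∷ʳ a zs
  = trans (descAgrees-insertLast w ℓ 0 (toList zs) a)
          (cong (λ j → descAgrees 0 (toList zs ∷ʳ a) w ∧ (punchIn ℓ a >ᵇ ℓ == w j)) (Vec.length-toList zs))

isPermWithDes : Word → Vec (Fin n) n → Bool
isPermWithDes w π = isPerm π ∧ hasDes π w

permsWithDes : ∀ n → Word → List (Vec (Fin n) n)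
permsWithDes n w = filterᵇ (isPermWithDes w) (allVecs n n)

∈-permsWithDes : {w : Word} (π : Vec (Fin n) n) → π ∈ permsWithDes n w ⇔ T (isPermWithDes w π)
∈-permsWithDes {n} {w} π = mk⇔
  (proj₂ ∘ ∈-filter⁻ (T? ∘ isPermWithDes w) {xs = allVecs n n})
  (∈-filter⁺ (T? ∘ isPermWithDes w) (∈-allVecs π))

permsWithDes-unique : ∀ n w → Unique (permsWithDes n w)
permsWithDes-unique n w = Unique.filter⁺ (T? ∘ isPermWithDes w) (allVecs-unique n n)

isPermWithDes-insertLast : (w : Word) (ℓ : Fin (suc (suc n))) (zs : Vec (Fin (suc n)) n) (a : Fin (suc n)) →
  isPermWithDes w (insertLast ℓ (zs Vec.∷ʳ a)) ≡ isPermWithDes w (zs Vec.∷ʳ a) ∧ (punchIn ℓ a >ᵇ ℓ == w n)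
isPermWithDes-insertLast {n} w ℓ zs a = begin
  isPerm (insertLast ℓ σ) ∧ hasDes (insertLast ℓ σ) w
    ≡⟨ cong₂ _∧_ (isPerm-insertLast ℓ σ) (hasDes-insertLast w ℓ zs a) ⟩
  isPerm σ ∧ (hasDes σ w ∧ bit)
    ≡⟨ sym (∧-assoc (isPerm σ) (hasDes σ w) bit) ⟩
  (isPerm σ ∧ hasDes σ w) ∧ bit
    ∎
  where
  open ≡-Reasoning
  σ : Vec (Fin (suc n)) (suc n)
  σ = zs Vec.∷ʳ a
  bit : Bool
  bit = punchIn ℓ a >ᵇ ℓ == w n

punchIn-image : (ℓ : Fin (suc n)) (ys : Vec (Fin (suc n)) k) → All (ℓ ≢_) (toList ys) →
  ∃ λ σ → Vec.map (punchIn ℓ) σ ≡ ys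
punchIn-image ℓ []       []           = [] , refl
punchIn-image ℓ (y ∷ ys) (ℓ≢y ∷ ℓ∉ys) =
  let σ , eq = punchIn-image ℓ ys ℓ∉ys in punchOut ℓ≢y ∷ σ , cong₂ _∷_ (punchIn-punchOut ℓ≢y) eq

insertLast-surjective : (π : Vec (Fin (suc n)) (suc k)) → Unique (toList π) →
  ∃ λ σ → π ≡ insertLast (Vec.last π) σ
insertLast-surjective {n} {k} π π! =
  let σ , eq = punchIn-image ℓ ys (AllPairs.head (to Unique-∷ʳ (subst Unique (Vec.toList-∷ʳ ℓ ys) π!′)))
  in σ , trans π≡ys∷ʳℓ (cong (Vec._∷ʳ ℓ) (sym eq))
  where
  ys : Vec (Fin (suc n)) k
  ys = Vec.init π
  ℓ : Fin (suc n)
  ℓ = Vec.last π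
  π≡ys∷ʳℓ : π ≡ ys Vec.∷ʳ ℓ
  π≡ys∷ʳℓ = proj₂ (proj₂ (Vec.initLast π))
  π!′ : Unique (toList (ys Vec.∷ʳ ℓ))
  π!′ = subst (Unique ∘ toList) π≡ys∷ʳℓ π!

isPermWithDes-insertLast-extremeFor : (w : Word) {σ : Vec (Fin (suc n)) (suc n)} →
  T (isPermWithDes w σ) → T (isPermWithDes w (insertLast (extremeFor (w n)) σ))
isPermWithDes-insertLast-extremeFor {n} w {σ} σ-good with Vec.initLast σ
... | zs , a , refl = subst T (sym (isPermWithDes-insertLast w ℓ zs a))
  (from T-∧ (σ-good , from T-== (>ᵇ-extremeFor (w n) (punchInᵢ≢i ℓ a))))
  where
  ℓ : Fin (suc (suc n))
  ℓ = extremeFor (w n)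

d[1+n]≤d[2+n] : ∀ n w → d (suc n) w ≤ d (suc (suc n)) w
d[1+n]≤d[2+n] n w = begin
  d (suc n) w                     ≡⟨ sym (length-map extend (permsWithDes (suc n) w)) ⟩
  length (map extend (permsWithDes (suc n) w))
    ≤⟨ unique-⊆⇒length-≤ (Unique.map⁺ (insertLast-injective ℓ) (permsWithDes-unique (suc n) w)) image⊆ ⟩
  d (suc (suc n)) w               ∎
  where
  open ℕ.≤-Reasoning
  ℓ : Fin (suc (suc n))
  ℓ = extremeFor (w n)
  extend : Vec (Fin (suc n)) (suc n) → Vec (Fin (suc (suc n))) (suc (suc n))
  extend = insertLast ℓ
  image⊆ : map extend (permsWithDes (suc n) w) ⊆ permsWithDes (suc (suc n)) w
  image⊆ π∈ with ∈-map⁻ extend π∈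
  ... | σ , σ∈ , refl = from (∈-permsWithDes (extend σ)) (isPermWithDes-insertLast-extremeFor w {σ} (to (∈-permsWithDes σ) σ∈))

isPermWithDes⇒insertLast : (w : Word) (π : Vec (Fin (suc (suc n))) (suc (suc n))) → T (isPermWithDes w π) →
  ∃₂ λ k σ → T (isPermWithDes w σ) × π ≡ insertLast (punchIn (extremeFor (not (w n))) k) σ
isPermWithDes⇒insertLast {n} w π π-good with insertLast-surjective π (to (T-distinct (toList π)) (proj₁ (to T-∧ π-good)))
... | σ , π≡ with Vec.initLast σ
... | zs , a , refl = punchOut c≢ℓ , σ , σ-good , trans π≡ (cong (λ j → insertLast j σ) (sym (punchIn-punchOut c≢ℓ)))
  where
  ℓ : Fin (suc (suc n))
  ℓ = Vec.last π
  σ-good×bit : T (isPermWithDes w σ) × T (punchIn ℓ a >ᵇ ℓ == w n)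
  σ-good×bit = to T-∧ (subst T (isPermWithDes-insertLast w ℓ zs a) (subst (T ∘ isPermWithDes w) π≡ π-good))
  σ-good : T (isPermWithDes w σ)
  σ-good = proj₁ σ-good×bit
  c≢ℓ : extremeFor (not (w n)) ≢ ℓ
  c≢ℓ = >ᵇ⇒≢extremeFor-not (punchInᵢ≢i ℓ a) (to T-== (proj₂ σ-good×bit)) ∘ sym

d[2+n]≤[1+n]*d[1+n] : ∀ n w → d (suc (suc n)) w ≤ suc n * d (suc n) w
d[2+n]≤[1+n]*d[1+n] n w = begin
  d (suc (suc n)) w
    ≤⟨ unique-⊆⇒length-≤ (permsWithDes-unique (suc (suc n)) w) ⊆image ⟩
  length (map extend candidates)  ≡⟨ length-map extend candidates ⟩
  length candidates               ≡⟨ length-cartesianProduct (allFin (suc n)) (permsWithDes (suc n) w) ⟩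
  length (allFin (suc n)) * d (suc n) w ≡⟨ cong (_* d (suc n) w) (length-tabulate {n = suc n} id) ⟩
  suc n * d (suc n) w             ∎
  where
  open ℕ.≤-Reasoning
  candidates : List (Fin (suc n) × Vec (Fin (suc n)) (suc n))
  candidates = cartesianProduct (allFin (suc n)) (permsWithDes (suc n) w)
  extend : Fin (suc n) × Vec (Fin (suc n)) (suc n) → Vec (Fin (suc (suc n))) (suc (suc n))
  extend (k , σ) = insertLast (punchIn (extremeFor (not (w n))) k) σ
  ⊆image : permsWithDes (suc (suc n)) w ⊆ map extend candidates
  ⊆image {π} π∈ with isPermWithDes⇒insertLast w π (to (∈-permsWithDes π) π∈)
  ... | k , σ , σ-good , refl =
    ∈-map⁺ extend (∈-cartesianProduct⁺ (∈-allFin k) (from (∈-permsWithDes σ) σ-good))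

lemma3p3 : (w : Word) (n : ℕ) → 2 ≤ n →
    (d (n ∸ 1) w ≤ d n w) × (d n w ≤ (n ∸ 1) * d (n ∸ 1) w)
lemma3p3 w (suc (suc n)) (s≤s (s≤s z≤n)) = d[1+n]≤d[2+n] n w , d[2+n]≤[1+n]*d[1+n] n w
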